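{- Let $n\ge 3$ and $\lambda=(\lambda_1,\dots,\lambda_n)\in\mathbb{Z}_{\ge 0}^n$. Every positive integer solution $(x_1,\dots,x_n)$ of \[ \sum_{i=1}^n X_i^2+\sum_{i=1}^n \lambda_i\, X_1\cdots\widehat{X_i}\cdots X_n=\Big(n+\sum_{i=1}^n\lambda_i\Big)\prod_{i=1}^n X_i \] is obtained from $(1,1,\dots,1)$ by finitely many mutations: there exist $t\ge 0$ and indices $w_1,\dots,w_t\in\{1,\dots,n\}$ with $w_{s+1}\neq w_s$ for all $1\le s<t$ such that \[ (x_1,\dots,x_n)=(\mu_{w_t}\circ\cdots\circ\mu_{w_1})(1,1,\dots,1). \]
   Context: $\widehat{X_i}$ means the factor $X_i$ is omitted. For $i\in\{1,\dots,n\}$, the mutation $\mu_i$ sends a point $(x_1,\dots,x_n)$ with positive entries to $(x_1,\dots,x_{i-1},x_i',x_{i+1},\dots,x_n)$, where \[ x_i'=\frac{\sum_{j\neq i}x_j^2+\lambda_i\prod_{j\neq i}x_j}{x_i}. \] -}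

module Defs where

open import Data.Nat as ℕ using (ℕ; zero; suc)
open import Data.Fin using (Fin; zero; suc; _≟_)
open import Data.Rational as ℚ using (ℚ; 0ℚ; 1ℚ; _+_; _*_; _÷_)
import Data.Rational.Properties as ℚP
open import Data.Integer using (+_)
open import Data.List using (List; []; _∷_)
open import Relation.Nullary using (yes; no; ¬_)
open import Relation.Binary.PropositionalEquality using (_≡_)

Σℕ : ∀ {n} → (Fin n → ℕ) → ℕ
Σℕ {zero}  f = 0
Σℕ {suc n} f = f zero ℕ.+ Σℕ (λ i → f (suc i))

Πℕ : ∀ {n} → (Fin n → ℕ) → ℕ
Πℕ {zero}  f = 1
Πℕ {suc n} f = f zero ℕ.* Πℕ (λ i → f (suc i))

Σℚ : ∀ {n} → (Fin n → ℚ) → ℚ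
Σℚ {zero}  f = 0ℚ
Σℚ {suc n} f = f zero + Σℚ (λ i → f (suc i))

Πℚ : ∀ {n} → (Fin n → ℚ) → ℚ
Πℚ {zero}  f = 1ℚ
Πℚ {suc n} f = f zero * Πℚ (λ i → f (suc i))

Σℕ-except : ∀ {n} → Fin n → (Fin n → ℕ) → ℕ
Σℕ-except i f = Σℕ (λ j → case-eq j)
  where case-eq : _ → ℕ
        case-eq j with j ≟ i
        ... | yes _ = 0
        ... | no _  = f j

Πℕ-except : ∀ {n} → Fin n → (Fin n → ℕ) → ℕ
Πℕ-except i f = Πℕ (λ j → case-eq j)
  where case-eq : _ → ℕ
        case-eq j with j ≟ i
        ... | yes _ = 1
        ... | no _  = f j

Σℚ-except : ∀ {n} → Fin n → (Fin n → ℚ) → ℚ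
Σℚ-except i f = Σℚ (λ j → case-eq j)
  where case-eq : _ → ℚ
        case-eq j with j ≟ i
        ... | yes _ = 0ℚ
        ... | no _  = f j

Πℚ-except : ∀ {n} → Fin n → (Fin n → ℚ) → ℚ
Πℚ-except i f = Πℚ (λ j → case-eq j)
  where case-eq : _ → ℚ
        case-eq j with j ≟ i
        ... | yes _ = 1ℚ
        ... | no _  = f j

IsSolution : (n : ℕ) → (lam : Fin n → ℕ) → (x : Fin n → ℕ) → Set
IsSolution n lam x =
  Σℕ (λ i → x i ℕ.* x i) ℕ.+ Σℕ (λ i → lam i ℕ.* Πℕ-except i x)
    ≡ (n ℕ.+ Σℕ lam) ℕ.* Πℕ x

-- Total division on ℚ (only ever used with positive denominators).
_÷'_ : ℚ → ℚ → ℚ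
p ÷' q with q ℚP.≟ 0ℚ
... | yes _ = 0ℚ
... | no q≢0 = _÷_ p q {{ℚ.≢-nonZero q≢0}}

mutation : ∀ {n} → (lam : Fin n → ℕ) → Fin n → (Fin n → ℚ) → (Fin n → ℚ)
mutation lam i x j with j ≟ i
... | no _  = x j
... | yes _ =
  (Σℚ-except i (λ k → x k * x k) + (+ lam i ℚ./ 1) * Πℚ-except i x) ÷' x i

mutateSeq : ∀ {n} → (lam : Fin n → ℕ) → List (Fin n) → (Fin n → ℚ) → (Fin n → ℚ)
mutateSeq lam []       x = x
mutateSeq lam (w ∷ ws) x = mutateSeq lam ws (mutation lam w x)

NoRepeat : ∀ {n} → List (Fin n) → Set
NoRepeat []             = Data.Unit.⊤ where import Data.Unit
NoRepeat (w ∷ [])       = Data.Unit.⊤ where import Data.Unit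
NoRepeat (w ∷ v ∷ ws)   = (¬ v ≡ w) Data.Product.× NoRepeat (v ∷ ws) where import Data.Product

ones : ∀ {n} → Fin n → ℚ
ones _ = 1ℚ

toℚ : ℕ → ℚ
toℚ m = + m ℚ./ 1

{-# OPTIONS --safe #-}
-- Fixing all coordinates but x_i, the equation becomes a quadratic
-- t * t + C + t * D = t * K in t = x_i whose coefficients only involve the other
-- coordinates; its second root b = C / x_i is the mutation of x at i.  Let x_i be
-- a maximal coordinate with x_i ≥ 2 and let P be the product of the others.  For
-- every t between the largest other coordinate and P, the value of the quadratic
-- at t is at most 1 - P (this uses n ≥ 3).  At t = x_i the value is 0, so P < x_i;
-- at t = P it is at most 0, so b ≤ P < x_i.  Mutating at a maximal coordinate
-- therefore lowers the coordinate sum and keeps a positive solution, so repeated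
-- mutation reaches (1, …, 1), and reading the steps backwards builds x.  Two
-- consecutive indices differ: after a step at i, coordinate i holds the smaller
-- root, but every descent step starts from a coordinate holding the larger root.

module Submission where

open import Defs
open import Data.Nat using (ℕ; _≤_; _>_)
open import Data.Fin using (Fin)
open import Data.List using (List)
open import Data.Product using (Σ; _×_)
open import Relation.Binary.PropositionalEquality using (_≡_)

open import Algebra.Bundles using (Monoid)
import Algebra.Properties.Monoid.Sum as MonoidSum
open import Algebra.Properties.CommutativeSemigroup using (x∙yz≈y∙xz; xy∙z≈xz∙y)
open import Data.Empty using (⊥-elim)
open import Data.Fin.Base using (zero; suc; punchIn)
open import Data.Fin.Properties using (_≟_; punchInᵢ≢i; punchIn-injective)
import Data.Integer.Base as ℤ
import Data.Integer.Properties as ℤ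
open import Data.List.Base using ([]; _∷_; _∷ʳ_; last; allFin)
open import Data.List.Extrema.Nat using (argmax; f[xs]≤f[argmax])
open import Data.List.Membership.Propositional.Properties using (∈-allFin)
import Data.List.Relation.Unary.All as All
open import Data.Maybe.Base using (just)
open import Data.Maybe.Relation.Unary.All as Maybe using (just; nothing)
open import Data.Nat.Base using (zero; suc; _+_; _*_; _<_; z≤n; s≤s; >-nonZero)
import Data.Nat.Coprimality as Coprime
open import Data.Nat.Induction using (<-wellFounded)
open import Data.Nat.Properties hiding (_≟_)
open import Data.Nat.Tactic.RingSolver using (solve-∀; solve)
open import Data.Product using (_,_; proj₁; ∃-syntax; Σ-syntax)
open import Data.Rational.Base as ℚ using (ℚ; mkℚ)
import Data.Rational.Properties as ℚ
open import Data.Unit using (tt)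
open import Data.Vec.Functional using (Vector; updateAt; removeAt; tail)
open import Data.Vec.Functional.Properties using (updateAt-updates; updateAt-minimal)
open import Function.Base using (_∘_; _on_; const)
open import Induction.WellFounded using (Acc; acc)
open import Relation.Binary.Construct.On using () renaming (wellFounded to on-wellFounded)
open import Relation.Binary.PropositionalEquality
  using (refl; sym; trans; cong; cong₂; subst; subst₂; _≢_; _≗_; module ≡-Reasoning)
open import Relation.Nullary using (Dec; yes; no; contradiction)

open import Algebra.Properties.Semiring.Sum +-*-semiring
  using (sum; sum-remove; sum-cong-≗; *-distribˡ-sum; *-distribʳ-sum)
open import Algebra.Properties.CommutativeMonoid.Sum *-1-commutativeMonoid
  using () renaming (sum to product; sum-remove to product-remove; sum-cong-≗ to product-cong-≗)

updateAt-congˡ : ∀ {A : Set} {n} {xs ys : Vector A n} i (f : A → A) →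
                 xs ≗ ys → updateAt xs i f ≗ updateAt ys i f
updateAt-congˡ zero f xs≗ys zero = cong f (xs≗ys zero)
updateAt-congˡ zero f xs≗ys (suc j) = xs≗ys (suc j)
updateAt-congˡ (suc i) f xs≗ys zero = xs≗ys zero
updateAt-congˡ (suc i) f xs≗ys (suc j) = updateAt-congˡ i f (xs≗ys ∘ suc) j

removeAt-updateAt : ∀ {A : Set} {n} (xs : Vector A (suc n)) i (f : A → A) →
                    removeAt (updateAt xs i f) i ≗ removeAt xs i
removeAt-updateAt xs i f j = updateAt-minimal (punchIn i j) i xs (punchInᵢ≢i i j)

removeAt-updateAt-punchIn : ∀ {A : Set} {n} (xs : Vector A (suc n)) i k (f : A → A) →
                            removeAt (updateAt xs (punchIn i k) f) i ≗ updateAt (removeAt xs i) k f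
removeAt-updateAt-punchIn xs i k f j with j ≟ k
... | yes refl = trans (updateAt-updates (punchIn i j) xs) (sym (updateAt-updates j (removeAt xs i)))
... | no j≢k = trans (updateAt-minimal (punchIn i j) (punchIn i k) xs (j≢k ∘ punchIn-injective i j k))
                     (sym (updateAt-minimal j k (removeAt xs i) j≢k))

module _ {c ℓ} (M : Monoid c ℓ) where
  open Monoid M
  open MonoidSum M using () renaming (sum to fold)

  fold-updateAt-ε : ∀ {n} (f : Vector Carrier (suc n)) i →
                    fold (updateAt f i (const ε)) ≈ fold (removeAt f i)
  fold-updateAt-ε f zero = identityˡ _
  fold-updateAt-ε {suc n} f (suc i) = ∙-congˡ (fold-updateAt-ε (tail f) i)

sum-updateAt-0 : ∀ {n} (f : Vector ℕ (suc n)) i → sum (updateAt f i (const 0)) ≡ sum (removeAt f i)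
sum-updateAt-0 = fold-updateAt-ε +-0-monoid

product-updateAt-1 : ∀ {n} (f : Vector ℕ (suc n)) i → product (updateAt f i (const 1)) ≡ product (removeAt f i)
product-updateAt-1 = fold-updateAt-ε *-1-monoid

product-updateAt-punchIn : ∀ {n} (x : Vector ℕ (suc n)) i k →
  product (updateAt x (punchIn i k) (const 1)) ≡ x i * product (updateAt (removeAt x i) k (const 1))
product-updateAt-punchIn x i k = begin
  product x′                       ≡⟨ product-remove {i = i} x′ ⟩
  x′ i * product (removeAt x′ i)   ≡⟨ cong₂ _*_ (updateAt-minimal i (punchIn i k) x (punchInᵢ≢i i k ∘ sym))
                                                (product-cong-≗ (removeAt-updateAt-punchIn x i k (const 1))) ⟩
  x i * product (updateAt (removeAt x i) k (const 1)) ∎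
  where
  open ≡-Reasoning
  x′ = updateAt x (punchIn i k) (const 1)

Positive : ∀ {n} → Vector ℕ n → Set
Positive x = ∀ j → 0 < x j

sum-mono-≤ : ∀ {n} {f g : Vector ℕ n} → (∀ j → f j ≤ g j) → sum f ≤ sum g
sum-mono-≤ {zero} f≤g = z≤n
sum-mono-≤ {suc n} f≤g = +-mono-≤ (f≤g zero) (sum-mono-≤ (f≤g ∘ suc))

product-positive : ∀ {n} {g : Vector ℕ n} → Positive g → 0 < product g
product-positive {zero} g>0 = s≤s z≤n
product-positive {suc n} g>0 = *-mono-≤ (g>0 zero) (product-positive (g>0 ∘ suc))

factor-≤-product : ∀ {n} {g : Vector ℕ n} → Positive g → ∀ j → g j ≤ product g
factor-≤-product {g = g} g>0 zero = m≤m*n (g zero) _ {{>-nonZero (product-positive (g>0 ∘ suc))}}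
factor-≤-product {g = g} g>0 (suc j) =
  ≤-trans (factor-≤-product (g>0 ∘ suc) j) (m≤n*m _ (g zero) {{>-nonZero (g>0 zero)}})

product-updateAt-1-≤ : ∀ {n} (g : Vector ℕ n) k → 0 < g k → product (updateAt g k (const 1)) ≤ product g
product-updateAt-1-≤ g zero gₖ>0 = *-monoˡ-≤ _ gₖ>0
product-updateAt-1-≤ g (suc k) gₖ>0 = *-monoʳ-≤ (g zero) (product-updateAt-1-≤ (tail g) k gₖ>0)

m+[n+o]≤m*n+[1+o] : ∀ {m n} o → 0 < m → 0 < n → m + (n + o) ≤ m * n + suc o
m+[n+o]≤m*n+[1+o] {suc m} {suc n} o _ _ = subst (suc m + (suc n + o) ≤_) (identity m n o) (m≤m+n _ (m * n))
  where
  identity : ∀ m n o → suc m + (suc n + o) + m * n ≡ suc m * suc n + suc o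
  identity = solve-∀

sum<product+n : ∀ {n} {g : Vector ℕ n} → Positive g → sum g < product g + n
sum<product+n {zero} g>0 = s≤s z≤n
sum<product+n {suc n} {g} g>0 = begin-strict
  g zero + sum (tail g)           <⟨ +-monoʳ-< (g zero) (sum<product+n (g>0 ∘ suc)) ⟩
  g zero + (product (tail g) + n) ≤⟨ m+[n+o]≤m*n+[1+o] n (g>0 zero) (product-positive (g>0 ∘ suc)) ⟩
  g zero * product (tail g) + suc n ∎
  where open ≤-Reasoning

Σℕ≡sum : ∀ {n} (f : Vector ℕ n) → Σℕ f ≡ sum f
Σℕ≡sum {zero} f = refl
Σℕ≡sum {suc n} f = cong (f zero +_) (Σℕ≡sum (f ∘ suc))

Πℕ≡product : ∀ {n} (f : Vector ℕ n) → Πℕ f ≡ product f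
Πℕ≡product {zero} f = refl
Πℕ≡product {suc n} f = cong (f zero *_) (Πℕ≡product (f ∘ suc))

toℚ-mkℚ : ∀ a → toℚ a ≡ mkℚ (ℤ.+ a) 0 (Coprime.sym (Coprime.1-coprimeTo a))
toℚ-mkℚ a = ℚ.normalize-coprime (Coprime.sym (Coprime.1-coprimeTo a))

toℚ-+ : ∀ a b → toℚ a ℚ.+ toℚ b ≡ toℚ (a + b)
toℚ-+ a b = begin
  toℚ a ℚ.+ toℚ b                               ≡⟨ cong₂ ℚ._+_ (toℚ-mkℚ a) (toℚ-mkℚ b) ⟩
  (ℤ.+ a ℤ.* ℤ.+ 1 ℤ.+ ℤ.+ b ℤ.* ℤ.+ 1) ℚ./ 1   ≡⟨ cong₂ (λ u v → (u ℤ.+ v) ℚ./ 1)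
                                                         (ℤ.*-identityʳ (ℤ.+ a)) (ℤ.*-identityʳ (ℤ.+ b)) ⟩
  (ℤ.+ a ℤ.+ ℤ.+ b) ℚ./ 1                       ≡⟨ cong (ℚ._/ 1) (sym (ℤ.pos-+ a b)) ⟩
  toℚ (a + b)                                   ∎
  where open ≡-Reasoning

toℚ-* : ∀ a b → toℚ a ℚ.* toℚ b ≡ toℚ (a * b)
toℚ-* a b = begin
  toℚ a ℚ.* toℚ b            ≡⟨ cong₂ ℚ._*_ (toℚ-mkℚ a) (toℚ-mkℚ b) ⟩
  (ℤ.+ a ℤ.* ℤ.+ b) ℚ./ 1    ≡⟨ cong (ℚ._/ 1) (sym (ℤ.pos-* a b)) ⟩
  toℚ (a * b)                ∎
  where open ≡-Reasoning

toℚ-÷' : ∀ a c → 0 < a → toℚ (a * c) ÷' toℚ a ≡ toℚ c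
toℚ-÷' a@(suc _) c _ with toℚ a ℚ.≟ ℚ.0ℚ
... | yes a≡0 with () ← trans (sym (toℚ-mkℚ a)) a≡0
... | no a≢0 = begin
  toℚ (a * c) ℚ.* ℚ.1/ toℚ a          ≡⟨ cong (ℚ._* ℚ.1/ toℚ a)
                                               (trans (cong toℚ (*-comm a c)) (sym (toℚ-* c a))) ⟩
  toℚ c ℚ.* toℚ a ℚ.* ℚ.1/ toℚ a      ≡⟨ ℚ.*-assoc (toℚ c) (toℚ a) _ ⟩
  toℚ c ℚ.* (toℚ a ℚ.* ℚ.1/ toℚ a)    ≡⟨ cong (toℚ c ℚ.*_) (ℚ.*-inverseʳ (toℚ a)) ⟩
  toℚ c ℚ.* ℚ.1ℚ                      ≡⟨ ℚ.*-identityʳ (toℚ c) ⟩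
  toℚ c                               ∎
  where
  open ≡-Reasoning
  instance _ = ℚ.≢-nonZero a≢0

Σℚ-toℚ : ∀ {n} {F : Vector ℚ n} {f} → F ≗ toℚ ∘ f → Σℚ F ≡ toℚ (sum f)
Σℚ-toℚ {zero} F≗ = refl
Σℚ-toℚ {suc n} {f = f} F≗ = trans (cong₂ ℚ._+_ (F≗ zero) (Σℚ-toℚ (F≗ ∘ suc))) (toℚ-+ (f zero) _)

Πℚ-toℚ : ∀ {n} {F : Vector ℚ n} {f} → F ≗ toℚ ∘ f → Πℚ F ≡ toℚ (product f)
Πℚ-toℚ {zero} F≗ = refl
Πℚ-toℚ {suc n} {f = f} F≗ = trans (cong₂ ℚ._*_ (F≗ zero) (Πℚ-toℚ (F≗ ∘ suc))) (toℚ-* (f zero) _)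

-- Πℕ-except, Σℚ-except and Πℚ-except fold a summand that Defs binds in a `where`
-- block; these equations name it, so that `with j ≟ i` can then evaluate it.
private
  Πℕ-except-unfold : ∀ {n} (i : Fin n) (f : Vector ℕ n) → Σ[ h ∈ Vector ℕ n ] Πℕ-except i f ≡ Πℕ h
  Πℕ-except-unfold i f = _ , refl

  Σℚ-except-unfold : ∀ {n} (i : Fin n) (F : Vector ℚ n) → Σ[ h ∈ Vector ℚ n ] Σℚ-except i F ≡ Σℚ h
  Σℚ-except-unfold i F = _ , refl

  Πℚ-except-unfold : ∀ {n} (i : Fin n) (F : Vector ℚ n) → Σ[ h ∈ Vector ℚ n ] Πℚ-except i F ≡ Πℚ h
  Πℚ-except-unfold i F = _ , refl

Πℕ-except≡product : ∀ {n} (i : Fin n) (f : Vector ℕ n) → Πℕ-except i f ≡ product (updateAt f i (const 1))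
Πℕ-except≡product i f = trans (Πℕ≡product (proj₁ (Πℕ-except-unfold i f))) (product-cong-≗ summand)
  where
  summand : proj₁ (Πℕ-except-unfold i f) ≗ updateAt f i (const 1)
  summand j with j ≟ i
  ... | yes j≡i = sym (trans (cong (updateAt f i (const 1)) j≡i) (updateAt-updates i f))
  ... | no j≢i = sym (updateAt-minimal j i f j≢i)

Σℚ-except-toℚ : ∀ {n} (i : Fin (suc n)) {F : Vector ℚ (suc n)} {f} →
                F ≗ toℚ ∘ f → Σℚ-except i F ≡ toℚ (sum (removeAt f i))
Σℚ-except-toℚ i {F} {f} F≗ =
  trans (Σℚ-toℚ {f = updateAt f i (const 0)} summand) (cong toℚ (sum-updateAt-0 f i))
  where
  summand : proj₁ (Σℚ-except-unfold i F) ≗ toℚ ∘ updateAt f i (const 0)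
  summand j with j ≟ i
  ... | yes j≡i = cong toℚ (sym (trans (cong (updateAt f i (const 0)) j≡i) (updateAt-updates i f)))
  ... | no j≢i = trans (F≗ j) (cong toℚ (sym (updateAt-minimal j i f j≢i)))

Πℚ-except-toℚ : ∀ {n} (i : Fin (suc n)) {F : Vector ℚ (suc n)} {f} →
                F ≗ toℚ ∘ f → Πℚ-except i F ≡ toℚ (product (removeAt f i))
Πℚ-except-toℚ i {F} {f} F≗ =
  trans (Πℚ-toℚ {f = updateAt f i (const 1)} summand) (cong toℚ (product-updateAt-1 f i))
  where
  summand : proj₁ (Πℚ-except-unfold i F) ≗ toℚ ∘ updateAt f i (const 1)
  summand j with j ≟ i
  ... | yes j≡i = cong toℚ (sym (trans (cong (updateAt f i (const 1)) j≡i) (updateAt-updates i f)))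
  ... | no j≢i = trans (F≗ j) (cong toℚ (sym (updateAt-minimal j i f j≢i)))

mutation-self : ∀ {n} (lam : Vector ℕ n) i X →
  mutation lam i X i ≡ (Σℚ-except i (λ k → X k ℚ.* X k) ℚ.+ toℚ (lam i) ℚ.* Πℚ-except i X) ÷' X i
mutation-self lam i X with i ≟ i
... | yes _ = refl
... | no i≢i = ⊥-elim (i≢i refl)

mutation-other : ∀ {n} (lam : Vector ℕ n) {i j} X → j ≢ i → mutation lam i X j ≡ X j
mutation-other lam {i} {j} X j≢i with j ≟ i
... | yes j≡i = ⊥-elim (j≢i j≡i)
... | no _ = refl

mutateSeq-∷ʳ : ∀ {n} (lam : Vector ℕ n) ws i X →
               mutateSeq lam (ws ∷ʳ i) X ≡ mutation lam i (mutateSeq lam ws X)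
mutateSeq-∷ʳ lam [] i X = refl
mutateSeq-∷ʳ lam (w ∷ ws) i X = mutateSeq-∷ʳ lam ws i (mutation lam w X)

last-∷ʳ : ∀ {A : Set} (xs : List A) x → last (xs ∷ʳ x) ≡ just x
last-∷ʳ [] x = refl
last-∷ʳ (y ∷ []) x = refl
last-∷ʳ (y ∷ z ∷ xs) x = last-∷ʳ (z ∷ xs) x

NoRepeat-∷ʳ : ∀ {n} {ws : List (Fin n)} {i} → NoRepeat ws → Maybe.All (i ≢_) (last ws) → NoRepeat (ws ∷ʳ i)
NoRepeat-∷ʳ {ws = []} _ _ = tt
NoRepeat-∷ʳ {ws = w ∷ []} _ (just i≢w) = i≢w , tt
NoRepeat-∷ʳ {ws = w ∷ v ∷ ws} (v≢w , no-repeat) i≢last = v≢w , NoRepeat-∷ʳ no-repeat i≢last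

vieta-partner : ∀ {a c d k} → 0 < a → a * a + c + a * d ≡ a * k → ∃[ b ] a + b + d ≡ k
vieta-partner {a} {c} {d} {k} a>0 a-root =
  let b , a+d+b≡k = m≤n⇒∃[o]m+o≡n a+d≤k in b , trans (xy∙z≈xz∙y +-commutativeSemigroup a b d) a+d+b≡k
  where
  a+d≤k : a + d ≤ k
  a+d≤k = *-cancelˡ-≤ a {{>-nonZero a>0}} (begin
    a * (a + d)        ≤⟨ m≤m+n _ c ⟩
    a * (a + d) + c    ≡⟨ solve (a ∷ c ∷ d ∷ []) ⟩
    a * a + c + a * d  ≡⟨ a-root ⟩
    a * k              ∎)
    where open ≤-Reasoning

vieta-product : ∀ {a b c d k} → a + b + d ≡ k → a * a + c + a * d ≡ a * k → a * b ≡ c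
vieta-product {a} {b} {c} {d} {k} a+b+d≡k a-root =
  +-cancelˡ-≡ (a * a) _ _ (+-cancelʳ-≡ (a * d) _ _ (begin
    a * a + a * b + a * d  ≡⟨ solve (a ∷ b ∷ d ∷ []) ⟩
    a * (a + b + d)        ≡⟨ cong (a *_) a+b+d≡k ⟩
    a * k                  ≡⟨ a-root ⟨
    a * a + c + a * d      ∎))
  where open ≡-Reasoning

vieta-other-root : ∀ {a b c d k} → a + b + d ≡ k → a * b ≡ c → b * b + c + b * d ≡ b * k
vieta-other-root {a} {b} {c} {d} {k} a+b+d≡k ab≡c = begin
  b * b + c + b * d      ≡⟨ cong (λ v → b * b + v + b * d) ab≡c ⟨
  b * b + a * b + b * d  ≡⟨ solve (a ∷ b ∷ d ∷ []) ⟩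
  b * (a + b + d)        ≡⟨ cong (b *_) a+b+d≡k ⟩
  b * k                  ∎
  where open ≡-Reasoning

-- Writing t = suc t′, p = t + u and m = suc (suc r), the difference of the two
-- sides is a polynomial in t′, u, r, li, Λ with nonnegative coefficients.
quadratic-bound : ∀ {t p m li Λ q s d} →
                  0 < t → t ≤ p → 2 ≤ m → q ≤ t * s → s < p + m → d ≤ Λ * p →
                  t * t + (q + li * p) + t * d + p ≤ t * ((suc m + (li + Λ)) * p) + 1
quadratic-bound {suc t′} {p} {suc (suc r)} {li} {Λ} {q} {s} {d} _ t≤p (s≤s (s≤s z≤n)) q≤ts s<p+m d≤Λp
  with u , refl ← m≤n⇒∃[o]m+o≡n t≤p = begin
    T * T + (q + li * P) + T * d + P
      ≤⟨ +-monoˡ-≤ P (+-mono-≤ (+-monoʳ-≤ (T * T) (+-monoˡ-≤ (li * P) q≤T[P+r+1]))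
                               (*-monoʳ-≤ T d≤Λp)) ⟩
    T * T + (T * (P + suc r) + li * P) + T * (Λ * P) + P
      ≤⟨ m≤m+n _ _ ⟩
    T * T + (T * (P + suc r) + li * P) + T * (Λ * P) + P
      + (t′ * r + suc r * t′ * t′ + u * suc r + t′ * u * (2 + r) + li * P * t′)
      ≡⟨ slack-identity t′ u r li Λ ⟩
    T * ((3 + r + (li + Λ)) * P) + 1 ∎
  where
  open ≤-Reasoning
  T = suc t′
  P = T + u
  slack-identity : ∀ t u r li Λ →
    suc t * suc t + (suc t * (suc t + u + suc r) + li * (suc t + u)) + suc t * (Λ * (suc t + u)) + (suc t + u)
      + (t * r + suc r * t * t + u * suc r + t * u * (2 + r) + li * (suc t + u) * t)
    ≡ suc t * ((3 + r + (li + Λ)) * (suc t + u)) + 1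
  slack-identity = solve-∀
  q≤T[P+r+1] : q ≤ T * (P + suc r)
  q≤T[P+r+1] = ≤-trans q≤ts (*-monoʳ-≤ T (≤-pred (subst (s <_) (+-suc P (suc r)) s<p+m)))

root-≤-of-nonpositive : ∀ {t a b} → t < a → t * t + a * b ≤ t * (a + b) → b ≤ t
root-≤-of-nonpositive {t} {a} {b} t<a nonpositive with b ≤? t
... | yes b≤t = b≤t
... | no b≰t with u , refl ← m≤n⇒∃[o]m+o≡n t<a | v , refl ← m≤n⇒∃[o]m+o≡n (≰⇒> b≰t) =
  contradiction nonpositive (<⇒≱ (begin-strict
    t * (a + b)                                 <⟨ m<m+n _ (s≤s z≤n) ⟩
    t * (a + b) + suc u * suc v                 ≡⟨ excess-identity t u v ⟩
    t * t + a * b                               ∎))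
  where
  open ≤-Reasoning
  excess-identity : ∀ t u v → t * (suc t + u + (suc t + v)) + suc u * suc v ≡ t * t + (suc t + u) * (suc t + v)
  excess-identity = solve-∀

module Descent {r} (lam : Vector ℕ (suc (suc r))) where

  Point : Set
  Point = Vector ℕ (suc (suc r))

  Index : Set
  Index = Fin (suc (suc r))

  Solution : Point → Set
  Solution = IsSolution (suc (suc r)) lam

  N : ℕ
  N = suc (suc r) + sum lam

  -- P, C, D, K only involve the coordinates other than the i-th, so that the equation
  -- is the quadratic IsRoot in x i; its roots a, b satisfy a + b + D = K and a * b = C.
  P C D K : Index → Point → ℕ
  P i x = product (removeAt x i)
  C i x = sum (removeAt (λ j → x j * x j) i) + lam i * P i x
  D i x = sum (λ k → lam (punchIn i k) * product (updateAt (removeAt x i) k (const 1)))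
  K i x = N * P i x

  IsRoot : Index → Point → ℕ → Set
  IsRoot i x t = t * t + C i x + t * D i x ≡ t * K i x

  Partner : Index → Point → ℕ → Set
  Partner i x b = x i + b + D i x ≡ K i x

  IsSolution-lhs : ∀ i x →
    Σℕ (λ j → x j * x j) + Σℕ (λ k → lam k * Πℕ-except k x) ≡ x i * x i + C i x + x i * D i x
  IsSolution-lhs i x = begin
    Σℕ sq + Σℕ (λ k → lam k * Πℕ-except k x)
      ≡⟨ cong₂ _+_ (Σℕ≡sum sq) (trans (Σℕ≡sum (λ k → lam k * Πℕ-except k x))
                                      (sum-cong-≗ λ k → cong (lam k *_) (Πℕ-except≡product k x))) ⟩
    sum sq + sum L
      ≡⟨ cong₂ _+_ (sum-remove {i = i} sq) (sum-remove {i = i} L) ⟩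
    x i * x i + S + (L i + sum (removeAt L i))
      ≡⟨ cong₂ (λ u v → x i * x i + S + (lam i * u + v)) (product-updateAt-1 x i) others ⟩
    x i * x i + S + (lam i * P i x + x i * D i x)
      ≡⟨ trans (sym (+-assoc (x i * x i + S) (lam i * P i x) (x i * D i x)))
               (cong (_+ x i * D i x) (+-assoc (x i * x i) S (lam i * P i x))) ⟩
    x i * x i + C i x + x i * D i x ∎
    where
    open ≡-Reasoning
    sq L : Vector ℕ (suc (suc r))
    sq j = x j * x j
    L k = lam k * product (updateAt x k (const 1))
    S = sum (removeAt sq i)
    Q : Vector ℕ (suc r)
    Q k = product (updateAt (removeAt x i) k (const 1))
    others : sum (removeAt L i) ≡ x i * D i x
    others = trans (sum-cong-≗ λ k → trans (cong (lam (punchIn i k) *_) (product-updateAt-punchIn x i k))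
                                           (x∙yz≈y∙xz *-commutativeSemigroup (lam (punchIn i k)) (x i) (Q k)))
                   (sym (*-distribˡ-sum (x i) (λ k → lam (punchIn i k) * Q k)))

  IsSolution-rhs : ∀ i x → (suc (suc r) + Σℕ lam) * Πℕ x ≡ x i * K i x
  IsSolution-rhs i x =
    trans (cong₂ (λ s p → (suc (suc r) + s) * p) (Σℕ≡sum lam) (trans (Πℕ≡product x) (product-remove x)))
          (x∙yz≈y∙xz *-commutativeSemigroup N (x i) (P i x))

  solution⇒root : ∀ i x → Solution x → IsRoot i x (x i)
  solution⇒root i x sol = trans (sym (IsSolution-lhs i x)) (trans sol (IsSolution-rhs i x))

  root⇒solution : ∀ i x → IsRoot i x (x i) → Solution x
  root⇒solution i x root = trans (IsSolution-lhs i x) (trans root (sym (IsSolution-rhs i x)))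

  partner-product : ∀ {x i b} → Solution x → Partner i x b → x i * b ≡ C i x
  partner-product {x} {i} sol partner = vieta-product {x i} partner (solution⇒root i x sol)

  partner-unique : ∀ {i x b b′} → Partner i x b → Partner i x b′ → b ≡ b′
  partner-unique {i} {x} p p′ = +-cancelˡ-≡ (x i) _ _ (+-cancelʳ-≡ (D i x) _ _ (trans p (sym p′)))

  partner-positive : ∀ {i x b} → Positive x → Solution x → Partner i x b → 0 < b
  partner-positive {i} {x} {zero} pos sol partner =
    contradiction (trans (sym (*-zeroʳ (x i))) (partner-product {x} {i} sol partner)) (<⇒≢ C>0)
    where
    x₀ = x (punchIn i zero)
    C>0 : 0 < C i x
    C>0 = ≤-trans (*-mono-≤ (pos (punchIn i zero)) (pos (punchIn i zero)))
                  (≤-trans (m≤m+n (x₀ * x₀) _) (m≤m+n _ _))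
  partner-positive {b = suc b} _ _ _ = s≤s z≤n

  jump : Point → Index → ℕ → Point
  jump x i b = updateAt x i (const b)

  jump-rest : ∀ x i b → removeAt (jump x i b) i ≗ removeAt x i
  jump-rest x i b = removeAt-updateAt x i (const b)

  P-jump : ∀ x i b → P i (jump x i b) ≡ P i x
  P-jump x i b = product-cong-≗ (jump-rest x i b)

  C-jump : ∀ x i b → C i (jump x i b) ≡ C i x
  C-jump x i b = cong₂ _+_ (sum-cong-≗ λ j → cong₂ _*_ (jump-rest x i b j) (jump-rest x i b j))
                           (cong (lam i *_) (P-jump x i b))

  D-jump : ∀ x i b → D i (jump x i b) ≡ D i x
  D-jump x i b = sum-cong-≗ λ k →
    cong (lam (punchIn i k) *_) (product-cong-≗ (updateAt-congˡ k (const 1) (jump-rest x i b)))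

  IsRoot-jump : ∀ x i b {t} → IsRoot i x t → IsRoot i (jump x i b) t
  IsRoot-jump x i b {t} root = begin
    t * t + C i (jump x i b) + t * D i (jump x i b)
      ≡⟨ cong₂ (λ c d → t * t + c + t * d) (C-jump x i b) (D-jump x i b) ⟩
    t * t + C i x + t * D i x                        ≡⟨ root ⟩
    t * K i x                                        ≡⟨ cong (λ p → t * (N * p)) (P-jump x i b) ⟨
    t * K i (jump x i b)                             ∎
    where open ≡-Reasoning

  jump-positive : ∀ {x i b} → Positive x → 0 < b → Positive (jump x i b)
  jump-positive {x} {i} pos b>0 j with j ≟ i
  ... | yes refl = subst (0 <_) (sym (updateAt-updates j x)) b>0
  ... | no j≢i = subst (0 <_) (sym (updateAt-minimal j i x j≢i)) (pos j)

  jump-solution : ∀ {x i b} → Solution x → Partner i x b → Solution (jump x i b)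
  jump-solution {x} {i} {b} sol partner =
    root⇒solution i (jump x i b) (subst (IsRoot i (jump x i b)) (sym (updateAt-updates i x))
      (IsRoot-jump x i b {b} (vieta-other-root {x i} partner (partner-product {x} {i} sol partner))))

  jump-partner : ∀ {x i b} → Partner i x b → Partner i (jump x i b) (x i)
  jump-partner {x} {i} {b} partner = begin
    jump x i b i + x i + D i (jump x i b)  ≡⟨ cong₂ (λ v d → v + x i + d) (updateAt-updates i x) (D-jump x i b) ⟩
    b + x i + D i x                        ≡⟨ cong (_+ D i x) (+-comm b (x i)) ⟩
    x i + b + D i x                        ≡⟨ partner ⟩
    K i x                                  ≡⟨ cong (N *_) (P-jump x i b) ⟨
    K i (jump x i b)                       ∎
    where open ≡-Reasoning

  jump-sum-< : ∀ {x i b} → b < x i → sum (jump x i b) < sum x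
  jump-sum-< {x} {i} {b} b<a = begin-strict
    sum (jump x i b)                              ≡⟨ sum-remove {i = i} (jump x i b) ⟩
    jump x i b i + sum (removeAt (jump x i b) i)  ≡⟨ cong₂ _+_ (updateAt-updates i x) (sum-cong-≗ (jump-rest x i b)) ⟩
    b + sum (removeAt x i)                        <⟨ +-monoˡ-< (sum (removeAt x i)) b<a ⟩
    x i + sum (removeAt x i)                      ≡⟨ sum-remove {i = i} x ⟨
    sum x                                         ∎
    where open ≤-Reasoning

  root-bound : ∀ {x i t} → 0 < r → Positive x → 0 < t → t ≤ P i x → (∀ j → x (punchIn i j) ≤ t) →
               t * t + C i x + t * D i x + P i x ≤ t * K i x + 1
  root-bound {x} {i} {t} r>0 pos t>0 t≤P rest≤t =
    subst (λ s → t * t + C i x + t * D i x + P i x ≤ t * ((suc (suc r) + s) * P i x) + 1)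
          (sym (sum-remove {i = i} lam))
      (quadratic-bound {li = lam i} t>0 t≤P (s≤s r>0) squares≤ (sum<product+n (pos ∘ punchIn i)) D≤)
    where
    g = removeAt x i
    squares≤ : sum (λ j → g j * g j) ≤ t * sum g
    squares≤ = ≤-trans (sum-mono-≤ λ j → *-monoˡ-≤ (g j) (rest≤t j)) (≤-reflexive (sym (*-distribˡ-sum t g)))
    D≤ : D i x ≤ sum (removeAt lam i) * P i x
    D≤ = ≤-trans (sum-mono-≤ λ k → *-monoʳ-≤ (lam (punchIn i k)) (product-updateAt-1-≤ g k (pos (punchIn i k))))
                 (≤-reflexive (sym (*-distribʳ-sum (P i x) (removeAt lam i))))

  max-exceeds-product : ∀ {x i} → 0 < r → Positive x → Solution x →
                        (∀ j → x j ≤ x i) → 2 ≤ x i → P i x < x i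
  max-exceeds-product {x} {i} r>0 pos sol max a≥2 with x i ≤? P i x
  ... | no a≰P = ≰⇒> a≰P
  ... | yes a≤P = contradiction (≤-trans a≥2 a≤P) (≤⇒≯ P≤1)
    where
    open ≤-Reasoning
    P≤1 : P i x ≤ 1
    P≤1 = +-cancelˡ-≤ (x i * K i x) _ _ (begin
      x i * K i x + P i x                      ≡⟨ cong (_+ P i x) (solution⇒root i x sol) ⟨
      x i * x i + C i x + x i * D i x + P i x  ≤⟨ root-bound r>0 pos (pos i) a≤P (max ∘ punchIn i) ⟩
      x i * K i x + 1                          ∎)

  partner-≤-product : ∀ {x i b} → 0 < r → Positive x → Solution x →
                      P i x < x i → Partner i x b → b ≤ P i x
  partner-≤-product {x} {i} {b} r>0 pos sol p<a partner =
    root-≤-of-nonpositive p<a (+-cancelʳ-≤ (p * D i x) _ _ (begin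
      p * p + x i * b + p * D i x  ≡⟨ cong (λ c → p * p + c + p * D i x) (partner-product {x} {i} sol partner) ⟩
      p * p + C i x + p * D i x    ≤⟨ nonpositive ⟩
      p * K i x                    ≡⟨ cong (p *_) partner ⟨
      p * (x i + b + D i x)        ≡⟨ *-distribˡ-+ p (x i + b) (D i x) ⟩
      p * (x i + b) + p * D i x    ∎))
    where
    open ≤-Reasoning
    p = P i x
    rest>0 = pos ∘ punchIn i
    nonpositive : p * p + C i x + p * D i x ≤ p * K i x
    nonpositive = +-cancelʳ-≤ 1 _ _ (begin
      p * p + C i x + p * D i x + 1  ≤⟨ +-monoʳ-≤ _ (product-positive rest>0) ⟩
      p * p + C i x + p * D i x + p
        ≤⟨ root-bound r>0 pos (product-positive rest>0) ≤-refl (factor-≤-product rest>0) ⟩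
      p * K i x + 1                  ∎)

  descend : ∀ {x i} → 0 < r → Positive x → Solution x → (∀ j → x j ≤ x i) → 2 ≤ x i →
            ∃[ b ] b < x i × Partner i x b
  descend {x} {i} r>0 pos sol max a≥2 =
    let b , partner = vieta-partner (pos i) (solution⇒root i x sol)
        p<a = max-exceeds-product r>0 pos sol max a≥2
    in b , ≤-<-trans (partner-≤-product r>0 pos sol p<a partner) p<a , partner

  mutation-jump : ∀ {X : Vector ℚ (suc (suc r))} {y i c} → X ≗ toℚ ∘ y → 0 < y i → y i * c ≡ C i y →
                  mutation lam i X i ≡ toℚ c
  mutation-jump {X} {y} {i} {c} X≗y y>0 yc≡C = begin
    mutation lam i X i
      ≡⟨ mutation-self lam i X ⟩
    (Σℚ-except i (λ k → X k ℚ.* X k) ℚ.+ toℚ (lam i) ℚ.* Πℚ-except i X) ÷' X i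
      ≡⟨ cong₂ _÷'_ numerator (X≗y i) ⟩
    toℚ (C i y) ÷' toℚ (y i)
      ≡⟨ cong (λ v → toℚ v ÷' toℚ (y i)) yc≡C ⟨
    toℚ (y i * c) ÷' toℚ (y i)
      ≡⟨ toℚ-÷' (y i) c y>0 ⟩
    toℚ c ∎
    where
    open ≡-Reasoning
    squares : (λ k → X k ℚ.* X k) ≗ toℚ ∘ (λ k → y k * y k)
    squares k = trans (cong₂ ℚ._*_ (X≗y k) (X≗y k)) (toℚ-* (y k) (y k))
    numerator : Σℚ-except i (λ k → X k ℚ.* X k) ℚ.+ toℚ (lam i) ℚ.* Πℚ-except i X ≡ toℚ (C i y)
    numerator = begin
      Σℚ-except i (λ k → X k ℚ.* X k) ℚ.+ toℚ (lam i) ℚ.* Πℚ-except i X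
        ≡⟨ cong₂ (λ s p → s ℚ.+ toℚ (lam i) ℚ.* p) (Σℚ-except-toℚ i {f = λ k → y k * y k} squares)
                                                  (Πℚ-except-toℚ i {f = y} X≗y) ⟩
      toℚ (sum (removeAt (λ k → y k * y k) i)) ℚ.+ toℚ (lam i) ℚ.* toℚ (P i y)
        ≡⟨ cong (toℚ (sum (removeAt (λ k → y k * y k) i)) ℚ.+_) (toℚ-* (lam i) (P i y)) ⟩
      toℚ (sum (removeAt (λ k → y k * y k) i)) ℚ.+ toℚ (lam i * P i y)
        ≡⟨ toℚ-+ (sum (removeAt (λ k → y k * y k) i)) (lam i * P i y) ⟩
      toℚ (C i y) ∎

  DescentAt : Point → Index → Set
  DescentAt x j = ∃[ b ] b < x j × Partner j x b

  -- At the last index of ws, x holds the larger of the two roots.  After a jump at i,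
  -- coordinate i holds the smaller one, so i differs from the last index reaching the
  -- jumped point.
  Reachable : Point → Set
  Reachable x = Σ[ ws ∈ List Index ]
    NoRepeat ws × (mutateSeq lam ws ones ≗ toℚ ∘ x) × Maybe.All (DescentAt x) (last ws)

  reachable-ones : ∀ {x} → (∀ j → x j ≡ 1) → Reachable x
  reachable-ones x≡1 = [] , tt , (λ j → cong toℚ (sym (x≡1 j))) , nothing

  reachable-jump : ∀ {x i b} → Positive x → Solution x → b < x i → Partner i x b →
                   Reachable (jump x i b) → Reachable x
  reachable-jump {x} {i} {b} pos sol b<a partner (ws , no-repeat , ws↦y , last-descends) =
    ws ∷ʳ i , NoRepeat-∷ʳ no-repeat (Maybe.map i≢ last-descends) , ws∷ʳi↦x ,
    subst (Maybe.All (DescentAt x)) (sym (last-∷ʳ ws i)) (just (b , b<a , partner))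
    where
    y = jump x i b
    i≢ : ∀ {j} → DescentAt y j → i ≢ j
    i≢ (b′ , b′<b , partner′) refl =
      <-asym b<a (subst₂ _<_ (partner-unique {i} {y} partner′ (jump-partner {x} partner)) (updateAt-updates i x) b′<b)
    yi*a≡C : y i * x i ≡ C i y
    yi*a≡C = begin
      y i * x i  ≡⟨ cong (_* x i) (updateAt-updates i x) ⟩
      b * x i    ≡⟨ *-comm b (x i) ⟩
      x i * b    ≡⟨ partner-product {x} {i} sol partner ⟩
      C i x      ≡⟨ C-jump x i b ⟨
      C i y      ∎
      where open ≡-Reasoning
    mutation↦x : ∀ j → Dec (j ≡ i) → mutation lam i (mutateSeq lam ws ones) j ≡ toℚ (x j)
    mutation↦x j (yes refl) =
      mutation-jump {y = y} ws↦y (subst (0 <_) (sym (updateAt-updates i x)) (partner-positive pos sol partner)) yi*a≡C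
    mutation↦x j (no j≢i) =
      trans (mutation-other lam (mutateSeq lam ws ones) j≢i)
            (trans (ws↦y j) (cong toℚ (updateAt-minimal j i x j≢i)))
    ws∷ʳi↦x : mutateSeq lam (ws ∷ʳ i) ones ≗ toℚ ∘ x
    ws∷ʳi↦x j = trans (cong (λ X → X j) (mutateSeq-∷ʳ lam ws i ones)) (mutation↦x j (j ≟ i))

  reachable : 0 < r → ∀ x → Acc (_<_ on sum) x → Positive x → Solution x → Reachable x
  reachable r>0 x (acc smaller) pos sol =
    from-max (argmax x zero (allFin _)) (λ j → All.lookup (f[xs]≤f[argmax] {f = x} zero (allFin _)) (∈-allFin j))
    where
    from-max : ∀ i → (∀ j → x j ≤ x i) → Reachable x
    from-max i max with x i ≤? 1
    ... | yes a≤1 = reachable-ones λ j → ≤-antisym (≤-trans (max j) a≤1) (pos j)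
    ... | no a≰1 =
      let b , b<a , partner = descend {x} {i} r>0 pos sol max (≰⇒> a≰1)
      in reachable-jump {x} {i} pos sol b<a partner
           (reachable r>0 (jump x i b) (smaller (jump-sum-< {x} {i} b<a))
              (jump-positive {x} {i} pos (partner-positive {i} pos sol partner))
              (jump-solution {x} {i} sol partner))

theorem2p4 : (n : ℕ) → 3 ≤ n → (lam : Fin n → ℕ) → (x : Fin n → ℕ) →
    (∀ i → x i > 0) → IsSolution n lam x →
    Σ (List (Fin n)) (λ ws → NoRepeat ws ×
      (∀ i → mutateSeq lam ws ones i ≡ toℚ (x i)))
theorem2p4 (suc (suc (suc k))) (s≤s (s≤s (s≤s z≤n))) lam x pos sol =
  let ws , no-repeat , ws↦x , _ = reachable (s≤s z≤n) x (on-wellFounded sum <-wellFounded x) pos sol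
  in ws , no-repeat , ws↦x
  where open Descent lam
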